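{- For every finite simple graph $G$ and every integer $k\ge1$, the clique number of the $k$-supertoken graph satisfies $\omega(\mathcal F_k(G))=\omega(G)$.
   Context: The $k$-supertoken graph $\mathcal F_k(G)$ has as vertices all multisets of size $k$ of elements of $V(G)$; two multisets $A,B$ are adjacent iff $A=S\uplus\{u\}$, $B=S\uplus\{v\}$ for some multiset $S$ of size $k-1$ and some edge $uv\in E(G)$, where $\uplus$ is multiset sum. $\omega$ denotes the clique number. -}

module Defs where

open import Level using (0ℓ)
open import Data.Nat using (ℕ; zero; suc; _≤_)
open import Data.Fin using (Fin; _≟_)
open import Data.Vec using (Vec; tabulate; zipWith; sum)
open import Data.List using (List; length)
open import Data.List.Relation.Unary.AllPairs using (AllPairs)
open import Data.List.Relation.Unary.Unique.Propositional using (Unique)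
open import Data.Product using (Σ; ∃; ∃-syntax; _×_; _,_)
open import Relation.Nullary using (¬_; yes; no)
open import Relation.Binary.PropositionalEquality using (_≡_)

record SimpleGraph (n : ℕ) : Set₁ where
  field
    Adj    : Fin n → Fin n → Set
    sym    : ∀ {u v} → Adj u v → Adj v u
    irrefl : ∀ {u} → ¬ Adj u u

record Graph : Set₁ where
  field
    V   : Set
    Adj : V → V → Set

IsClique : (H : Graph) → List (Graph.V H) → Set
IsClique H xs = Unique xs × AllPairs (Graph.Adj H) xs

IsCliqueNumber : Graph → ℕ → Set
IsCliqueNumber H m =
  (Σ (List (Graph.V H)) λ xs → IsClique H xs × length xs ≡ m) ×
  (∀ xs → IsClique H xs → length xs ≤ m)

toGraph : ∀ {n} → SimpleGraph n → Graph
toGraph {n} G = record { V = Fin n ; Adj = SimpleGraph.Adj G }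

-- Multisets of elements of Fin n represented by multiplicity vectors.
Multiset : ℕ → Set
Multiset n = Vec ℕ n

_⊎ₘ_ : ∀ {n} → Multiset n → Multiset n → Multiset n
_⊎ₘ_ = zipWith Data.Nat._+_

singleton : ∀ {n} → Fin n → Multiset n
singleton u = tabulate λ i → ind (i ≟ u)
  where
  open import Relation.Nullary using (Dec)
  ind : ∀ {P : Set} → Dec P → ℕ
  ind (yes _) = 1
  ind (no _)  = 0

size : ∀ {n} → Multiset n → ℕ
size = sum

SuperToken : ∀ {n} → SimpleGraph n → ℕ → Graph
SuperToken {n} G k = record
  { V   = Σ (Multiset n) λ A → size A ≡ k
  ; Adj = λ { (A , _) (B , _) →
        ∃[ S ] ∃[ u ] ∃[ v ]
          (size S Data.Nat.+ 1 ≡ k) × SimpleGraph.Adj G u v ×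
          (A ≡ S ⊎ₘ singleton u) × (B ≡ S ⊎ₘ singleton v) }
  }

module Submission where

-- Read a multiset as an integer vector on V(G); adjacency in F_k(G) is then a move X ↦ X − δu + δv of one
-- token along an edge uv. If two vectors of a clique are S + δb and S + δc, a third member adjacent to both
-- is either S + δa (a star with core S) or the apex S + δb + δc − δa, and an apex is adjacent to no fourth
-- star member. By induction every clique of size ≥ 2 is a star {S + δx} or a co-star {T − δx}, and in
-- both cases the points x form a clique of G of the same size. Negation X ↦ −X turns co-stars into stars
-- and preserves adjacency, which is why we work over ℤ. Conversely a clique C of G lifts to the clique
-- {S + δx | x ∈ C} for any S of size k − 1.

open import Defs
open import Data.Nat as ℕ using (ℕ; _≤_; suc; _∸_)
import Data.Nat.Properties as ℕ
open import Algebra.Properties.CommutativeSemigroup ℕ.+-commutativeSemigroup using (interchange)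
open import Data.Integer using (ℤ; +_; -_; _+_; _-_)
import Data.Integer.Properties as ℤ
open import Data.Integer.Tactic.RingSolver using (solve-∀)
open import Algebra.Properties.AbelianGroup ℤ.+-0-abelianGroup using (∙-cancelˡ; ∙-cancelʳ)
open import Algebra.Properties.CommutativeSemigroup ℤ.+-commutativeSemigroup using (xy∙z≈xz∙y)
open import Data.Fin using (Fin; _≟_) renaming (zero to fzero; suc to fsuc)
open import Data.Fin.Properties using (suc-injective)
open import Data.Vec using (Vec; []; _∷_; lookup; replicate; sum)
open import Data.Vec.Properties using (lookup∘tabulate; lookup-zipWith; lookup-replicate)
open import Data.List using (List; []; _∷_; length; map)
open import Data.List.Properties using (length-map)
open import Data.List.Relation.Unary.All as All using (All; []; _∷_)
open import Data.List.Relation.Unary.AllPairs as AllPairs using (AllPairs; []; _∷_)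
open import Data.List.Relation.Unary.AllPairs.Properties using (map⁺)
open import Data.Product using (Σ; ∃; _×_; _,_; proj₁; proj₂)
open import Data.Sum using (_⊎_; inj₁; inj₂)
open import Data.Empty using (⊥-elim)
open import Function.Base using (_∋_; _∘_)
open import Relation.Nullary using (¬_; yes; no)
open import Relation.Binary.PropositionalEquality
open ≡-Reasoning

private
  variable
    n : ℕ

ℤ^_ : ℕ → Set
ℤ^ n = Fin n → ℤ

infixl 6 _⊕_
_⊕_ : ℤ^ n → ℤ^ n → ℤ^ n
(X ⊕ Y) y = X y + Y y

⊖_ : ℤ^ n → ℤ^ n
(⊖ X) y = - X y

-- ℤ's _+_ computes, so Agda cannot read X off X y + A y: leading vectors are therefore explicit arguments,
-- and Covers and Move below are records rather than Σ-types.
⊕-cancelˡ : ∀ (X : ℤ^ n) {A B} → X ⊕ A ≗ X ⊕ B → A ≗ B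
⊕-cancelˡ X h y = ∙-cancelˡ (X y) _ _ (h y)

⊕-balance : ∀ (X S : ℤ^ n) {A B C D} → X ⊕ A ≗ S ⊕ B → X ⊕ C ≗ S ⊕ D → B ⊕ C ≗ D ⊕ A
⊕-balance X S {A} {B} {C} {D} h₁ h₂ y = ∙-cancelˡ (X y + S y) _ _ (begin
  (X y + S y) + (B y + C y) ≡⟨ regroup (X y) (S y) (B y) (C y) ⟩
  (S y + B y) + (X y + C y) ≡⟨ cong₂ _+_ (sym (h₁ y)) (h₂ y) ⟩
  (X y + A y) + (S y + D y) ≡⟨ regroup′ (X y) (A y) (S y) (D y) ⟩
  (X y + S y) + (D y + A y) ∎)
  where
  regroup : ∀ x s b c → (x + s) + (b + c) ≡ (s + b) + (x + c)
  regroup = solve-∀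
  regroup′ : ∀ x a s d → (x + a) + (s + d) ≡ (x + s) + (d + a)
  regroup′ = solve-∀

⊕-rebase : ∀ (X S : ℤ^ n) {A Y P B} → X ⊕ A ≗ Y ⊕ P → Y ≗ S ⊕ B → X ⊕ A ≗ S ⊕ (B ⊕ P)
⊕-rebase X S {P = P} {B} h hY y =
  trans (h y) (trans (cong (_+ P y) (hY y)) (ℤ.+-assoc (S y) (B y) (P y)))

⊕-cancel-shared : ∀ (S : ℤ^ n) {X A P} → X ⊕ A ≗ S ⊕ (A ⊕ P) → X ≗ S ⊕ P
⊕-cancel-shared S {X} {A} {P} h y =
  ∙-cancelʳ (A y) (X y) (S y + P y) (trans (h y) (regroup (S y) (A y) (P y)))
  where
  regroup : ∀ s a p → s + (a + p) ≡ (s + p) + a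
  regroup = solve-∀

⊕-swap-base : ∀ (S : ℤ^ n) {X Y B C} → X ≗ S ⊕ B → Y ≗ S ⊕ C → Y ⊕ B ≗ X ⊕ C
⊕-swap-base S {X} {Y} {B} {C} hX hY y = begin
  Y y + B y         ≡⟨ cong (_+ B y) (hY y) ⟩
  (S y + C y) + B y ≡⟨ xy∙z≈xz∙y (S y) (C y) (B y) ⟩
  (S y + B y) + C y ≡⟨ cong (_+ C y) (hX y) ⟨
  X y + C y         ∎

common-base : ∀ (X Y : ℤ^ n) {A B} → X ⊕ A ≗ Y ⊕ B → ∃ λ S → X ≗ S ⊕ B × Y ≗ S ⊕ A
common-base X Y {A} {B} h = X ⊕ ⊖ B , (λ y → sub-add (X y) (B y)) , λ y → begin
  Y y                   ≡⟨ add-sub (Y y) (B y) ⟩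
  (Y y + B y) - B y     ≡⟨ cong (_- B y) (h y) ⟨
  (X y + A y) - B y     ≡⟨ regroup (X y) (A y) (B y) ⟩
  (X y - B y) + A y     ∎
  where
  sub-add : ∀ x b → x ≡ (x - b) + b
  sub-add = solve-∀
  add-sub : ∀ y b → y ≡ (y + b) - b
  add-sub = solve-∀
  regroup : ∀ x a b → (x + a) - b ≡ (x - b) + a
  regroup = solve-∀

⊖-shift : ∀ (X : ℤ^ n) {A T} → X ⊕ A ≗ T → ⊖ X ≗ ⊖ T ⊕ A
⊖-shift X {A} h y = trans (neg-add-add (X y) (A y)) (cong (λ t → - t + A y) (h y))
  where
  neg-add-add : ∀ x a → - x ≡ - (x + a) + a
  neg-add-add = solve-∀

⊖-balance : ∀ (X Y : ℤ^ n) {A B} → X ⊕ A ≗ Y ⊕ B → ⊖ X ⊕ B ≗ ⊖ Y ⊕ A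
⊖-balance X Y {A} {B} h y = begin
  - X y + B y                   ≡⟨ regroup (X y) (Y y) (B y) ⟩
  (- X y - Y y) + (Y y + B y)   ≡⟨ cong (λ t → (- X y - Y y) + t) (h y) ⟨
  (- X y - Y y) + (X y + A y)   ≡⟨ regroup′ (X y) (Y y) (A y) ⟩
  - Y y + A y                   ∎
  where
  regroup : ∀ x y b → - x + b ≡ (- x - y) + (y + b)
  regroup = solve-∀
  regroup′ : ∀ x y a → (- x - y) + (x + a) ≡ - y + a
  regroup′ = solve-∀

toℤ : Multiset n → ℤ^ n
toℤ A y = + lookup A y

toℤ-⊎ₘ : (A B : Multiset n) → toℤ (A ⊎ₘ B) ≗ toℤ A ⊕ toℤ B
toℤ-⊎ₘ A B y = cong +_ (lookup-zipWith ℕ._+_ y A B)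

δ : Fin n → ℤ^ n
δ a = toℤ (singleton a)

-- The indicator inside singleton is private to Defs, so we abstract y ≟ a in lookup∘tabulate's statement.
lookup-singleton-self : (a : Fin n) → lookup (singleton a) a ≡ 1
lookup-singleton-self a with a ≟ a | (lookup (singleton a) a ≡ _ ∋ lookup∘tabulate _ a)
... | yes _  | eq = eq
... | no a≢a | _  = ⊥-elim (a≢a refl)

lookup-singleton-other : ∀ {a y : Fin n} → y ≢ a → lookup (singleton a) y ≡ 0
lookup-singleton-other {a = a} {y} y≢a
  with y ≟ a | (lookup (singleton a) y ≡ _ ∋ lookup∘tabulate _ y)
... | yes y≡a | _  = ⊥-elim (y≢a y≡a)
... | no _    | eq = eq

δ-self : (a : Fin n) → δ a a ≡ + 1
δ-self a = cong +_ (lookup-singleton-self a)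

δ-other : ∀ {a y : Fin n} → y ≢ a → δ a y ≡ + 0
δ-other y≢a = cong +_ (lookup-singleton-other y≢a)

+suc≢+0 : ∀ {m} → + suc m ≢ + 0
+suc≢+0 ()

δ-injective : ∀ {a b : Fin n} → δ a ≗ δ b → a ≡ b
δ-injective {a = a} {b} h with a ≟ b
... | yes a≡b = a≡b
... | no a≢b  = ⊥-elim (+suc≢+0 (trans (sym (δ-self a)) (trans (h a) (δ-other a≢b))))

δ-pair : ∀ {a b c d : Fin n} → δ a ⊕ δ b ≗ δ c ⊕ δ d → a ≡ c × b ≡ d ⊎ a ≡ d × b ≡ c
δ-pair {a = a} {b} {c} {d} h with a ≟ c | a ≟ d
... | yes refl | _        = inj₁ (refl , δ-injective (⊕-cancelˡ (δ a) h))
... | no _     | yes refl =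
  inj₂ (refl , δ-injective (⊕-cancelˡ (δ a) (λ y → trans (h y) (ℤ.+-comm (δ c y) (δ a y)))))
... | no a≢c   | no a≢d   = ⊥-elim (+suc≢+0 (begin
  + 1 + δ b a     ≡⟨ cong (_+ δ b a) (δ-self a) ⟨
  δ a a + δ b a   ≡⟨ h a ⟩
  δ c a + δ d a   ≡⟨ cong₂ _+_ (δ-other a≢c) (δ-other a≢d) ⟩
  + 0             ∎))

δ-∈₃ : ∀ {a b c x y z : Fin n} → δ a ⊕ δ b ⊕ δ c ≗ δ x ⊕ δ y ⊕ δ z → a ≡ x ⊎ a ≡ y ⊎ a ≡ z
δ-∈₃ {a = a} {b} {c} {x} {y} {z} h with a ≟ x | a ≟ y | a ≟ z
... | yes a≡x | _       | _       = inj₁ a≡x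
... | no _    | yes a≡y | _       = inj₂ (inj₁ a≡y)
... | no _    | no _    | yes a≡z = inj₂ (inj₂ a≡z)
... | no a≢x  | no a≢y  | no a≢z  = ⊥-elim (+suc≢+0 (begin
  + 1 + δ b a + δ c a     ≡⟨ cong (λ t → t + δ b a + δ c a) (δ-self a) ⟨
  δ a a + δ b a + δ c a   ≡⟨ h a ⟩
  δ x a + δ y a + δ z a   ≡⟨ cong₂ _+_ (cong₂ _+_ (δ-other a≢x) (δ-other a≢y)) (δ-other a≢z) ⟩
  + 0                     ∎))

record Covers (X S : ℤ^ n) : Set where
  constructor _,_
  field
    centre : Fin n
    covers : X ≗ S ⊕ δ centre

open Covers using (centre)

Star : List (ℤ^ n) → Set
Star {n} L = ∃ λ (S : ℤ^ n) → All (λ X → Covers X S) L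

centres : ∀ {S : ℤ^ n} {L} → All (λ X → Covers X S) L → List (Fin n)
centres = All.reduce centre

length-centres : ∀ {S : ℤ^ n} {L} (cs : All (λ X → Covers X S) L) → length (centres cs) ≡ length L
length-centres []       = refl
length-centres (_ ∷ cs) = cong suc (length-centres cs)

module TokenMoves {n : ℕ} (G : SimpleGraph n) where
  open SimpleGraph G renaming (sym to Adj-sym)

  Adj⇒≢ : ∀ {u v} → Adj u v → u ≢ v
  Adj⇒≢ uv refl = irrefl uv

  record Move (X Y : ℤ^ n) : Set where
    constructor move
    field
      from to : Fin n
      edge    : Adj from to
      moved   : X ⊕ δ to ≗ Y ⊕ δ from

  Move-irrefl : ∀ {X} → ¬ Move X X
  Move-irrefl {X} (move u v uv h) = Adj⇒≢ uv (sym (δ-injective (⊕-cancelˡ X h)))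

  Move-⊖ : ∀ {X Y} → Move X Y → Move (⊖ X) (⊖ Y)
  Move-⊖ {X} {Y} (move u v uv h) = move v u (Adj-sym uv) (⊖-balance X Y h)

  Move⇒centres-adjacent : ∀ {S X Y} (cX : Covers X S) (cY : Covers Y S) → Move X Y →
    Adj (centre cX) (centre cY)
  Move⇒centres-adjacent {S} {X} {Y} (b , hX) (c , hY) (move u v uv h)
    with δ-pair (⊕-balance X Y h (λ y → sym (⊕-swap-base S hX hY y)))
  ... | inj₁ (refl , refl) = uv
  ... | inj₂ (u≡v , _)     = ⊥-elim (Adj⇒≢ uv u≡v)

  Move⇒centres-distinct : ∀ {S X Y} (cX : Covers X S) (cY : Covers Y S) → Move X Y →
    centre cX ≢ centre cY
  Move⇒centres-distinct cX cY m = Adj⇒≢ (Move⇒centres-adjacent cX cY m)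

  -- Second alternative: A is the apex S + δb + δc − δa over X = S + δb and Y = S + δc.
  extend-star : ∀ {S X Y A} (cX : Covers X S) (cY : Covers Y S) → Move X Y → Move A X → Move A Y →
    Covers A S ⊎ ∃ λ a → a ≢ centre cX × a ≢ centre cY × A ⊕ δ a ≗ X ⊕ δ (centre cY)
  extend-star {S} {X} {Y} {A} cX@(b , hX) cY@(c , hY) mXY (move p q _ hAX) (move r s _ hAY)
    with q ≟ b | s ≟ c
  ... | yes refl | _        = inj₁ (p , ⊕-cancel-shared S (⊕-rebase A S hAX hX))
  ... | no _     | yes refl = inj₁ (r , ⊕-cancel-shared S (⊕-rebase A S hAY hY))
  ... | no q≢b   | no s≢c
    with δ-∈₃ (⊕-balance A S (⊕-rebase A S hAX hX) (⊕-rebase A S hAY hY))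
  ...   | inj₁ b≡c        = ⊥-elim (Move⇒centres-distinct cX cY mXY b≡c)
  ...   | inj₂ (inj₂ b≡q) = ⊥-elim (q≢b (sym b≡q))
  ...   | inj₂ (inj₁ refl)
    with δ-pair (⊕-balance A X (λ y → trans (hAY y) (⊕-swap-base S hX hY y)) hAX)
  ...     | inj₁ (refl , refl) = inj₂ (q , q≢b , s≢c , hAX)
  ...     | inj₂ (c≡s , _)     = ⊥-elim (s≢c (sym c≡s))

  ¬Move-to-third-petal : ∀ {S X Y Z A a} (cX : Covers X S) (cY : Covers Y S) (cZ : Covers Z S) →
    Move X Y → Move X Z → Move Y Z →
    A ⊕ δ a ≗ X ⊕ δ (centre cY) → a ≢ centre cX → a ≢ centre cY → ¬ Move A Z
  ¬Move-to-third-petal {S} {X} {Y} {Z} {A} {a} cX@(b , hX) cY@(c , hY) cZ@(d , hZ) mXY mXZ mYZ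
                       apex a≢b a≢c (move u v _ hAZ) =
    Move⇒centres-distinct cX cY mXY (trans b≡u (sym c≡u))
    where
    -- The move A → Z must take its token from b, and by symmetry also from c.
    source : ∀ {e f} → A ⊕ δ a ≗ S ⊕ (δ e ⊕ δ f) → e ≢ d → e ≢ a → e ≡ u
    source h e≢d e≢a with δ-∈₃ (⊕-balance A S h (⊕-rebase A S hAZ hZ))
    ... | inj₁ e≡d        = ⊥-elim (e≢d e≡d)
    ... | inj₂ (inj₁ e≡u) = e≡u
    ... | inj₂ (inj₂ e≡a) = ⊥-elim (e≢a e≡a)

    b≡u : b ≡ u
    b≡u = source (⊕-rebase A S apex hX) (Move⇒centres-distinct cX cZ mXZ) (λ b≡a → a≢b (sym b≡a))

    apex′ : A ⊕ δ a ≗ Y ⊕ δ b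
    apex′ y = trans (apex y) (sym (⊕-swap-base S hX hY y))

    c≡u : c ≡ u
    c≡u = source (⊕-rebase A S apex′ hY) (Move⇒centres-distinct cY cZ mYZ) (λ c≡a → a≢c (sym c≡a))

  join-star : ∀ {S A B C D} → Covers B S → Covers C S → Covers D S → Move B C → Move B D → Move C D →
    Move A B → Move A C → Move A D → Covers A S
  join-star cB cC cD mBC mBD mCD mAB mAC mAD with extend-star cB cC mBC mAB mAC
  ... | inj₁ cA = cA
  ... | inj₂ (a , a≢b , a≢c , apex) =
    ⊥-elim (¬Move-to-third-petal cB cC cD mBC mBD mCD apex a≢b a≢c mAD)

  pair-star : ∀ {A B} → Move A B → Star (A ∷ B ∷ [])
  pair-star {A} {B} (move u v _ h) with common-base A B h
  ... | S , hA , hB = S , (u , hA) ∷ (v , hB) ∷ []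

  triangle-star : ∀ {A B C} → Move A B → Move A C → Move B C →
    Star (A ∷ B ∷ C ∷ []) ⊎ Star (map ⊖_ (A ∷ B ∷ C ∷ []))
  triangle-star {A} {B} {C} mAB mAC mBC@(move b c _ h) with common-base B C h
  ... | S , hB , hC with extend-star (b , hB) (c , hC) mBC mAB mAC
  ...   | inj₁ cover = inj₁ (S , cover ∷ (b , hB) ∷ (c , hC) ∷ [])
  ...   | inj₂ (a , _ , _ , apex) =
    inj₂ (⊖ (B ⊕ δ c) , (a , ⊖-shift A apex) ∷ (c , ⊖-shift B (λ _ → refl))
                        ∷ (b , ⊖-shift C (λ y → sym (h y))) ∷ [])

  clique-star : ∀ A B L → AllPairs Move (A ∷ B ∷ L) →
    Star (A ∷ B ∷ L) ⊎ Star (map ⊖_ (A ∷ B ∷ L))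
  clique-star A B [] ((mAB ∷ []) ∷ _) = inj₁ (pair-star mAB)
  clique-star A B (C ∷ []) ((mAB ∷ mAC ∷ []) ∷ (mBC ∷ []) ∷ _) = triangle-star mAB mAC mBC
  clique-star A B (C ∷ D ∷ L) ((mAB ∷ mAC ∷ mAD ∷ _) ∷ ms@((mBC ∷ mBD ∷ _) ∷ (mCD ∷ _) ∷ _))
    with clique-star B C (D ∷ L) ms
  ... | inj₁ (S , cB ∷ cC ∷ cD ∷ cs) =
    inj₁ (S , join-star cB cC cD mBC mBD mCD mAB mAC mAD ∷ cB ∷ cC ∷ cD ∷ cs)
  ... | inj₂ (S , cB ∷ cC ∷ cD ∷ cs) =
    inj₂ (S , join-star cB cC cD (Move-⊖ mBC) (Move-⊖ mBD) (Move-⊖ mCD) (Move-⊖ mAB) (Move-⊖ mAC) (Move-⊖ mAD)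
            ∷ cB ∷ cC ∷ cD ∷ cs)

  centres-adjacent : ∀ {S X L} (cX : Covers X S) (cs : All (λ Y → Covers Y S) L) → All (Move X) L →
    All (Adj (centre cX)) (centres cs)
  centres-adjacent _        []        []       = []
  centres-adjacent cX (cY ∷ cs) (m ∷ ms) = Move⇒centres-adjacent cX cY m ∷ centres-adjacent cX cs ms

  centres-clique : ∀ {S L} (cs : All (λ X → Covers X S) L) → AllPairs Move L →
    IsClique (toGraph G) (centres cs)
  centres-clique cs ms = AllPairs.map Adj⇒≢ (adjacent cs ms) , adjacent cs ms
    where
    adjacent : ∀ {S L} (cs : All (λ X → Covers X S) L) → AllPairs Move L → AllPairs Adj (centres cs)
    adjacent []       []        = []
    adjacent (c ∷ cs) (m ∷ ms)  = centres-adjacent c cs m ∷ adjacent cs ms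

  clique-of-Moves : ∀ A B L → AllPairs Move (A ∷ B ∷ L) →
    ∃ λ xs → IsClique (toGraph G) xs × length xs ≡ length (A ∷ B ∷ L)
  clique-of-Moves A B L ms with clique-star A B L ms
  ... | inj₁ (_ , cs) = centres cs , centres-clique cs ms , length-centres cs
  ... | inj₂ (_ , cs) = centres cs , centres-clique cs (map⁺ (AllPairs.map Move-⊖ ms)) ,
                        trans (length-centres cs) (length-map ⊖_ (A ∷ B ∷ L))

sum-zeros : (A : Vec ℕ n) → (∀ i → lookup A i ≡ 0) → sum A ≡ 0
sum-zeros []      _ = refl
sum-zeros (x ∷ A) h = cong₂ ℕ._+_ (h fzero) (sum-zeros A (λ i → h (fsuc i)))

sum-single-support : (A : Vec ℕ n) (a : Fin n) → (∀ i → i ≢ a → lookup A i ≡ 0) → sum A ≡ lookup A a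
sum-single-support (x ∷ A) fzero    h =
  trans (cong (x ℕ.+_) (sum-zeros A (λ i → h (fsuc i) (λ ())))) (ℕ.+-identityʳ x)
sum-single-support (x ∷ A) (fsuc a) h =
  cong₂ ℕ._+_ (h fzero (λ ())) (sum-single-support A a (λ i i≢a → h (fsuc i) (i≢a ∘ suc-injective)))

size-singleton : (a : Fin n) → size (singleton a) ≡ 1
size-singleton a =
  trans (sum-single-support (singleton a) a (λ _ → lookup-singleton-other)) (lookup-singleton-self a)

size-⊎ₘ : (A B : Multiset n) → size (A ⊎ₘ B) ≡ size A ℕ.+ size B
size-⊎ₘ []      []      = refl
size-⊎ₘ (a ∷ A) (b ∷ B) = trans (cong ((a ℕ.+ b) ℕ.+_) (size-⊎ₘ A B)) (interchange a b (sum A) (sum B))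

multiset-of-size : Fin n → (j : ℕ) → Σ (Multiset n) λ S → size S ≡ j
multiset-of-size {suc n} _ j =
  j ∷ replicate n 0 ,
  trans (cong (j ℕ.+_) (sum-zeros (replicate n 0) (λ i → lookup-replicate i 0))) (ℕ.+-identityʳ j)

element-of-positive-size : (A : Multiset n) → 1 ≤ size A → Fin n
element-of-positive-size (_ ∷ _) _ = fzero

module _ {n : ℕ} (G : SimpleGraph n) {k : ℕ} where
  open TokenMoves G

  vector : Graph.V (SuperToken G k) → ℤ^ n
  vector A = toℤ (proj₁ A)

  SuperToken-Adj⇒Move : ∀ {A B} → Graph.Adj (SuperToken G k) A B → Move (vector A) (vector B)
  SuperToken-Adj⇒Move (S , u , v , _ , uv , refl , refl) = move u v uv λ y → begin
    toℤ (S ⊎ₘ singleton u) y + δ v y ≡⟨ cong (_+ δ v y) (toℤ-⊎ₘ S (singleton u) y) ⟩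
    toℤ S y + δ u y + δ v y          ≡⟨ xy∙z≈xz∙y (toℤ S y) (δ u y) (δ v y) ⟩
    toℤ S y + δ v y + δ u y          ≡⟨ cong (_+ δ u y) (toℤ-⊎ₘ S (singleton v) y) ⟨
    toℤ (S ⊎ₘ singleton v) y + δ u y ∎

  SuperToken-irrefl : ∀ {A B} → Graph.Adj (SuperToken G k) A B → A ≢ B
  SuperToken-irrefl {A} adj refl = Move-irrefl (SuperToken-Adj⇒Move {A} {A} adj)

  SuperToken-clique : 1 ≤ k → ∀ {xs} → IsClique (toGraph G) xs →
    ∃ λ ys → IsClique (SuperToken G k) ys × length ys ≡ length xs
  SuperToken-clique _   {[]}     _         = [] , ([] , []) , refl
  SuperToken-clique k≥1 {c ∷ xs} (_ , adj) =
    map token (c ∷ xs) , (AllPairs.map SuperToken-irrefl adj′ , adj′) , length-map token (c ∷ xs)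
    where
    S : Multiset n
    S = proj₁ (multiset-of-size c (k ∸ 1))
    size-S+1 : size S ℕ.+ 1 ≡ k
    size-S+1 = trans (cong (ℕ._+ 1) (proj₂ (multiset-of-size c (k ∸ 1)))) (ℕ.m∸n+n≡m k≥1)
    token : Fin n → Graph.V (SuperToken G k)
    token v = S ⊎ₘ singleton v ,
              trans (size-⊎ₘ S (singleton v)) (trans (cong (size S ℕ.+_) (size-singleton v)) size-S+1)
    adj′ : AllPairs (Graph.Adj (SuperToken G k)) (map token (c ∷ xs))
    adj′ = map⁺ (AllPairs.map (λ uv → S , _ , _ , size-S+1 , uv , refl , refl) adj)

  SuperToken-clique-bound : 1 ≤ k → ∀ {m} → (∀ xs → IsClique (toGraph G) xs → length xs ≤ m) →
    ∀ ys → IsClique (SuperToken G k) ys → length ys ≤ m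
  SuperToken-clique-bound _   _     []       _ = ℕ.z≤n
  SuperToken-clique-bound k≥1 bound (y ∷ []) _ =
    bound (element-of-positive-size (proj₁ y) (subst (1 ≤_) (sym (proj₂ y)) k≥1) ∷ [])
          (([] ∷ []) , ([] ∷ []))
  SuperToken-clique-bound _ {m} bound (y₁ ∷ y₂ ∷ ys) (_ , adj)
    with clique-of-Moves (vector y₁) (vector y₂) (map vector ys)
                         (map⁺ (AllPairs.map (λ {A} {B} → SuperToken-Adj⇒Move {A} {B}) adj))
  ... | xs , clique , |xs| =
    subst (_≤ m) (trans |xs| (cong (λ l → suc (suc l)) (length-map vector ys))) (bound xs clique)

mainTheorem8 : (n : ℕ) (G : SimpleGraph n) (k : ℕ) → 1 ≤ k →
    (m : ℕ) → IsCliqueNumber (toGraph G) m → IsCliqueNumber (SuperToken G k) m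
mainTheorem8 n G k k≥1 m ((xs , clique , refl) , bound) =
  SuperToken-clique G k≥1 clique , SuperToken-clique-bound G k≥1 bound
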